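{- Let $a\ge 5$. In the $(a,5)$-game, Player 1 has a strategy such that, whatever Player 2 plays, by the end of Player 1's fourth move (at the latest) the game has not ended and the board is in a state belonging to $\widehat{S}$.
   Context: The $(a,b)$-game: Players 1 and 2 alternate moves, Player 1 first. After $n$ moves the state is a permutation $\pi\in\mathcal{S}_n$ (the first move gives $\pi=1$). A move from $\pi\in\mathcal{S}_n$ chooses $m\in\{1,\dots,n+1\}$ and replaces $\pi$ by $\pi'=\pi'_1\cdots\pi'_n m\in\mathcal{S}_{n+1}$ with $\pi'_i=\pi_i$ if $\pi_i\le m-1$ and $\pi'_i=\pi_i+1$ if $\pi_i\ge m$. The game ends when the permutation contains an increasing subsequence of length $a$ or a decreasing subsequence of length $b$; the player making that move loses. Board: for each entry $\pi_i$ of the current permutation, its cell is $(c_i,r_i)$, where $c_i$ (column) is the length of the longest increasing subsequence ending at $\pi_i$ and $r_i$ (row) the length of the longest decreasing subsequence ending at $\pi_i$. The set of shaded or eliminated cells is $S=\{(c,r): \exists i,\ c\le c_i,\ r\le r_i\}$. For the $(a,5)$-game the board has rows $r=1,2,3,4$ and columns $c=1,\dots,a-1$. For $r\in\{1,2,3,4\}$ let $\ell_r=\max\{c:(c,r)\in S\}$ (or $0$ if there is none), the number of shaded or eliminated cells in row $r$; the number of open cells in row $r$ is $a-1-\ell_r$. The board state is determined by $(\ell_1,\ell_2,\ell_3,\ell_4)$. $\widehat{S}$ is the set of board states satisfying one of: (1) $\ell_1=k$, $\ell_2=\ell_3=\ell_4=k-1$ for some $k\ge 2$, and $a-1-k$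 is odd; (2) $\ell_1=\ell_2=\ell_3=k$, $\ell_4=k-1$ for some $k\ge 1$, and $a-1-k$ is even; (3) $\ell_1=\ell_2=k$, $\ell_3=k-1$, $\ell_4=k-3$ for some $k\ge 3$, and $a-1-k$ is even; (4) $\ell_1=k$, $\ell_2=\ell_3=k-1$, $\ell_4=k-2$ for some $k\ge 2$, and $a-1-k$ is even; (5) $\ell_1=\ell_2=k$, $\ell_3=\ell_4=k-2$ for some $k\ge 3$, and $a-1-k>0$; (6) $\ell_1=k$, $\ell_2=k-1$, $\ell_3=k-2$, $\ell_4=k-3$ for some $k\ge 3$, and $a-1-k>0$; (7) $\ell_1=\ell_2+1$, $\ell_2\ge \ell_3+2$, $\ell_3=\ell_4+1$, and $a-1-\ell_1>0$. -}

module Defs where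

open import Data.Nat using (ℕ; zero; suc; _+_; _*_; _∸_; _≤_; _<_; _>_; _≤?_; _<?_; _>?_; _≤ᵇ_; _⊔_)
open import Data.Nat.Divisibility using (_∣_)
open import Data.Bool using (if_then_else_)
open import Data.List using (List; []; _∷_; _++_; [_]; map; filter; foldr; length)
open import Data.List.Relation.Unary.Linked using (Linked; linked?)
open import Data.List.Relation.Binary.Sublist.Propositional using (_⊆_)
open import Data.Product using (_×_; _,_; proj₁; proj₂; ∃)
open import Data.Sum using (_⊎_)
open import Data.Empty using (⊥)
open import Relation.Nullary using (¬_)
open import Relation.Binary.PropositionalEquality using (_≡_)

-- Permutations are lists of naturals π₁ ⋯ πₙ (one-line notation, values 1..n).

Perm : Set
Perm = List ℕ

step : Perm → ℕ → Perm
step π m = map (λ x → if m ≤ᵇ x then suc x else x) π ++ [ m ]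

LegalMove : Perm → ℕ → Set
LegalMove π m = (1 ≤ m) × (m ≤ suc (length π))

Increasing : List ℕ → Set
Increasing = Linked _<_

Decreasing : List ℕ → Set
Decreasing = Linked _>_

Ended : ℕ → ℕ → Perm → Set
Ended a b π =
  (∃ λ s → s ⊆ π × length s ≡ a × Increasing s) ⊎
  (∃ λ s → s ⊆ π × length s ≡ b × Decreasing s)

sublists : {A : Set} → List A → List (List A)
sublists [] = [ [] ]
sublists (x ∷ xs) = map (x ∷_) (sublists xs) ++ sublists xs

maxList : List ℕ → ℕ
maxList = foldr _⊔_ 0

lisEnd : Perm → ℕ → ℕ
lisEnd pre x = maxList (map length (filter (linked? _<?_) (map (_++ [ x ]) (sublists pre))))

ldsEnd : Perm → ℕ → ℕ
ldsEnd pre x = maxList (map length (filter (linked? _>?_) (map (_++ [ x ]) (sublists pre))))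

cellsFrom : Perm → Perm → List (ℕ × ℕ)
cellsFrom pre [] = []
cellsFrom pre (x ∷ rest) = (lisEnd pre x , ldsEnd pre x) ∷ cellsFrom (pre ++ [ x ]) rest

cells : Perm → List (ℕ × ℕ)
cells π = cellsFrom [] π

-- ℓ_r = max { c : (c , r) ∈ S } where S = {(c,r) : ∃ i, c ≤ cᵢ , r ≤ rᵢ}
-- i.e. the largest cᵢ among entries with r ≤ rᵢ (0 if there is none).
ell : Perm → ℕ → ℕ
ell π r = maxList (map proj₁ (filter (λ cell → r ≤? proj₂ cell) (cells π)))

-- Parity / positivity of the number of open cells a-1-k (with k ≤ a-1).

OpenEven : ℕ → ℕ → Set
OpenEven a k = (k ≤ a ∸ 1) × (2 ∣ (a ∸ 1 ∸ k))

OpenOdd : ℕ → ℕ → Set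
OpenOdd a k = (k ≤ a ∸ 1) × ¬ (2 ∣ (a ∸ 1 ∸ k))

OpenPos : ℕ → ℕ → Set
OpenPos a k = 0 < a ∸ 1 ∸ k

data InSHat (a : ℕ) : ℕ → ℕ → ℕ → ℕ → Set where
  c1 : ∀ k → 2 ≤ k → OpenOdd a k → InSHat a k (k ∸ 1) (k ∸ 1) (k ∸ 1)
  c2 : ∀ k → 1 ≤ k → OpenEven a k → InSHat a k k k (k ∸ 1)
  c3 : ∀ k → 3 ≤ k → OpenEven a k → InSHat a k k (k ∸ 1) (k ∸ 3)
  c4 : ∀ k → 2 ≤ k → OpenEven a k → InSHat a k (k ∸ 1) (k ∸ 1) (k ∸ 2)
  c5 : ∀ k → 3 ≤ k → OpenPos a k → InSHat a k k (k ∸ 2) (k ∸ 2)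
  c6 : ∀ k → 3 ≤ k → OpenPos a k → InSHat a k (k ∸ 1) (k ∸ 2) (k ∸ 3)
  c7 : ∀ l₁ l₂ l₃ l₄ → l₁ ≡ l₂ + 1 → l₃ + 2 ≤ l₂ → l₃ ≡ l₄ + 1 → OpenPos a l₁ →
       InSHat a l₁ l₂ l₃ l₄

BoardInSHat : ℕ → Perm → Set
BoardInSHat a π = InSHat a (ell π 1) (ell π 2) (ell π 3) (ell π 4)

-- Strategies for Player 1: the current permutation determines the whole
-- history (its prefixes, standardised), so a strategy is a map Perm → ℕ.

Strategy : Set
Strategy = Perm → ℕ

Reaches : ℕ → Strategy → ℕ → Perm → Set
Reaches a σ zero π = ⊥
Reaches a σ (suc t) π =
  LegalMove π (σ π) × ¬ Ended a 5 (step π (σ π)) ×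
  (BoardInSHat a (step π (σ π)) ⊎
   (∀ m → LegalMove (step π (σ π)) m →
      ¬ Ended a 5 (step (step π (σ π)) m) × Reaches a σ t (step (step π (σ π)) m)))

-- Whether the game has ended, and whether the board lies in Ŝ, depend on a only through
-- increasing subsequences of length a and the numbers a − 1 − k of open cells. Passing
-- from a to a + 2 can only postpone the end (an increasing subsequence of length a + 2
-- contains one of length a) and preserves the parity and the positivity of every
-- a − 1 − k, hence membership in Ŝ. So a strategy reaching Ŝ for a = 5 (resp. a = 6)
-- reaches it for every odd (resp. even) a ≥ 5, and these two finite game trees are
-- checked by exhaustive search over the replies of Player 2.

module Submission where

open import Defs
open import Data.Nat using (ℕ; _≤_)
open import Data.List using ([])
open import Data.Product using (∃)

open import Data.Nat using (zero; suc; _+_; _∸_; z≤n; s≤s; _≟_; _≤?_; _<?_; _>?_)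
open import Data.Nat.Properties using (m≤n⇒m≤o+n; m≤n+m; +-∸-assoc; ∸-monoˡ-≤; <-≤-trans)
open import Data.Nat.Divisibility using (_∣_; _∣?_; ∣-refl; ∣m∣n⇒∣m+n; ∣m+n∣m⇒∣n)
open import Data.List using (List; _∷_; length; map; applyUpTo)
open import Data.List.Membership.Propositional using (_∈_; find; lose)
open import Data.List.Membership.Propositional.Properties
  using (∈-applyUpTo⁺; ∈-map⁺; ∈-map⁻; ∈-++⁺ˡ; ∈-++⁺ʳ; ∈-++⁻)
open import Data.List.Relation.Binary.Sublist.Propositional using (_⊆_; []; _∷_; _∷ʳ_)
open import Data.List.Relation.Binary.Sublist.Propositional.Properties using (∷ˡ⁻)
open import Data.List.Relation.Unary.All as All using ()
open import Data.List.Relation.Unary.Any using (Any; here; any?)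
open import Data.List.Relation.Unary.Linked using (linked?; tail)
open import Data.Maybe using (Maybe; just; nothing; _<∣>_; _>>=_; from-just)
open import Data.Maybe.Effectful using (applicative)
open import Data.Product using (_×_; _,_)
open import Data.Sum using (inj₁; inj₂)
open import Effect.Applicative using (RawApplicative)
open import Function using (_∘_)
open import Level using (0ℓ)
open import Relation.Binary.PropositionalEquality using (refl; sym; subst)
open import Relation.Nullary using (¬_; Dec; yes; ¬?)
open import Relation.Nullary.Decidable using (_×-dec_; _⊎-dec_; map′; dec⇒maybe)
open import Relation.Unary using (Pred; Decidable)

open RawApplicative (applicative {0ℓ}) using (_<$>_; _<*>_)

Ended-pred : ∀ {a b π} → Ended (suc a) b π → Ended a b π
Ended-pred (inj₁ (_ ∷ s , s⊆π , refl , inc)) = inj₁ (s , ∷ˡ⁻ s⊆π , refl , tail inc)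
Ended-pred (inj₂ dec) = inj₂ dec

¬Ended-+2 : ∀ {a b π} → ¬ Ended a b π → ¬ Ended (2 + a) b π
¬Ended-+2 ¬end = ¬end ∘ Ended-pred ∘ Ended-pred

module _ {a : ℕ} where

  OpenEven-+2 : ∀ k → OpenEven (suc a) k → OpenEven (3 + a) k
  OpenEven-+2 k (k≤a , 2∣open) =
    m≤n⇒m≤o+n 2 k≤a , subst (2 ∣_) (sym (+-∸-assoc 2 k≤a)) (∣m∣n⇒∣m+n ∣-refl 2∣open)

  OpenOdd-+2 : ∀ k → OpenOdd (suc a) k → OpenOdd (3 + a) k
  OpenOdd-+2 k (k≤a , 2∤open) =
    m≤n⇒m≤o+n 2 k≤a ,
    λ 2∣open → 2∤open (∣m+n∣m⇒∣n (subst (2 ∣_) (+-∸-assoc 2 k≤a) 2∣open) ∣-refl)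

  OpenPos-+2 : ∀ k → OpenPos (suc a) k → OpenPos (3 + a) k
  OpenPos-+2 k pos = <-≤-trans pos (∸-monoˡ-≤ k (m≤n+m a 2))

InSHat-+2 : ∀ {a l₁ l₂ l₃ l₄} → InSHat (suc a) l₁ l₂ l₃ l₄ → InSHat (3 + a) l₁ l₂ l₃ l₄
InSHat-+2 (c1 k 2≤k o) = c1 k 2≤k (OpenOdd-+2 k o)
InSHat-+2 (c2 k 1≤k o) = c2 k 1≤k (OpenEven-+2 k o)
InSHat-+2 (c3 k 3≤k o) = c3 k 3≤k (OpenEven-+2 k o)
InSHat-+2 (c4 k 2≤k o) = c4 k 2≤k (OpenEven-+2 k o)
InSHat-+2 (c5 k 3≤k o) = c5 k 3≤k (OpenPos-+2 k o)
InSHat-+2 (c6 k 3≤k o) = c6 k 3≤k (OpenPos-+2 k o)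
InSHat-+2 (c7 l₁ l₂ l₃ l₄ e₁ e₂ e₃ o) = c7 l₁ l₂ l₃ l₄ e₁ e₂ e₃ (OpenPos-+2 l₁ o)

Reaches-+2 : ∀ {a} σ t π → Reaches (suc a) σ t π → Reaches (3 + a) σ t π
Reaches-+2 σ (suc t) π (legal , ¬end , inj₁ board) = legal , ¬Ended-+2 ¬end , inj₁ (InSHat-+2 board)
Reaches-+2 σ (suc t) π (legal , ¬end , inj₂ replies) = legal , ¬Ended-+2 ¬end , inj₂ λ m legal′ →
  let ¬end′ , next = replies m legal′ in ¬Ended-+2 ¬end′ , Reaches-+2 σ t _ next

module _ {A : Set} where

  sublists⁺ : ∀ {s xs : List A} → s ⊆ xs → s ∈ sublists xs
  sublists⁺ [] = here refl
  sublists⁺ {xs = y ∷ ys} (.y ∷ʳ s⊆ys) = ∈-++⁺ʳ (map (y ∷_) (sublists ys)) (sublists⁺ s⊆ys)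
  sublists⁺ (refl ∷ s⊆ys) = ∈-++⁺ˡ (∈-map⁺ (_ ∷_) (sublists⁺ s⊆ys))

  sublists⁻ : ∀ {s xs : List A} → s ∈ sublists xs → s ⊆ xs
  sublists⁻ {xs = []} (here refl) = []
  sublists⁻ {xs = y ∷ ys} s∈ with ∈-++⁻ (map (y ∷_) (sublists ys)) s∈
  ... | inj₂ s∈ys = y ∷ʳ sublists⁻ s∈ys
  ... | inj₁ s∈y∷ys with ∈-map⁻ (y ∷_) s∈y∷ys
  ...   | t , t∈ys , refl = refl ∷ sublists⁻ t∈ys

  ∃-sublist? : ∀ {P : Pred (List A) 0ℓ} → Decidable P → Decidable (λ xs → ∃ λ s → s ⊆ xs × P s)
  ∃-sublist? {P} P? xs = map′ fromAny toAny (any? P? (sublists xs))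
    where
    fromAny : Any P (sublists xs) → ∃ λ s → s ⊆ xs × P s
    fromAny any = let s , s∈ , ps = find any in s , sublists⁻ s∈ , ps
    toAny : (∃ λ s → s ⊆ xs × P s) → Any P (sublists xs)
    toAny (s , s⊆xs , ps) = lose (sublists⁺ s⊆xs) ps

ended? : ∀ a b π → Dec (Ended a b π)
ended? a b π =
  ∃-sublist? (λ s → length s ≟ a ×-dec linked? _<?_ s) π ⊎-dec
  ∃-sublist? (λ s → length s ≟ b ×-dec linked? _>?_ s) π

openEven? : ∀ a k → Dec (OpenEven a k)
openEven? a k = k ≤? a ∸ 1 ×-dec 2 ∣? (a ∸ 1 ∸ k)

openOdd? : ∀ a k → Dec (OpenOdd a k)
openOdd? a k = k ≤? a ∸ 1 ×-dec ¬? (2 ∣? (a ∸ 1 ∸ k))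

openPos? : ∀ a k → Dec (OpenPos a k)
openPos? a k = 0 <? a ∸ 1 ∸ k

atRows : ∀ {a l₁ m₂ m₃ m₄} l₂ l₃ l₄ → Maybe (InSHat a l₁ m₂ m₃ m₄) → Maybe (InSHat a l₁ l₂ l₃ l₄)
atRows {m₂ = m₂} {m₃} {m₄} l₂ l₃ l₄ h with l₂ ≟ m₂ | l₃ ≟ m₃ | l₄ ≟ m₄
... | yes refl | yes refl | yes refl = h
... | _ | _ | _ = nothing

inSHat? : ∀ a l₁ l₂ l₃ l₄ → Maybe (InSHat a l₁ l₂ l₃ l₄)
inSHat? a k l₂ l₃ l₄ =
  atRows l₂ l₃ l₄ (c1 k <$> dec⇒maybe (2 ≤? k) <*> dec⇒maybe (openOdd? a k)) <∣>
  atRows l₂ l₃ l₄ (c2 k <$> dec⇒maybe (1 ≤? k) <*> dec⇒maybe (openEven? a k)) <∣>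
  atRows l₂ l₃ l₄ (c3 k <$> dec⇒maybe (3 ≤? k) <*> dec⇒maybe (openEven? a k)) <∣>
  atRows l₂ l₃ l₄ (c4 k <$> dec⇒maybe (2 ≤? k) <*> dec⇒maybe (openEven? a k)) <∣>
  atRows l₂ l₃ l₄ (c5 k <$> dec⇒maybe (3 ≤? k) <*> dec⇒maybe (openPos? a k)) <∣>
  atRows l₂ l₃ l₄ (c6 k <$> dec⇒maybe (3 ≤? k) <*> dec⇒maybe (openPos? a k)) <∣>
  (c7 k l₂ l₃ l₄ <$> dec⇒maybe (k ≟ l₂ + 1) <*> dec⇒maybe (l₃ + 2 ≤? l₂)
                  <*> dec⇒maybe (l₃ ≟ l₄ + 1) <*> dec⇒maybe (openPos? a k))

moves : Perm → List ℕ
moves π = applyUpTo suc (suc (length π))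

legal⇒∈moves : ∀ {π m} → LegalMove π m → m ∈ moves π
legal⇒∈moves {m = suc i} (_ , m≤) = ∈-applyUpTo⁺ suc m≤

legal? : ∀ π m → Dec (LegalMove π m)
legal? π m = 1 ≤? m ×-dec m ≤? suc (length π)

∀-legal? : ∀ {P : ℕ → Set} π → (∀ m → Maybe (P m)) → Maybe (∀ m → LegalMove π m → P m)
∀-legal? π p? =
  (λ ps m legal → All.lookup ps (legal⇒∈moves {π} legal))
    <$> All.sequenceA 0ℓ applicative (All.tabulate {xs = moves π} λ {m} _ → p? m)

boardInSHat? : ∀ a π → Maybe (BoardInSHat a π)
boardInSHat? a π = inSHat? a (ell π 1) (ell π 2) (ell π 3) (ell π 4)

reaches? : ∀ a σ t π → Maybe (Reaches a σ t π)
reaches? a σ zero π = nothing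
reaches? a σ (suc t) π = do
  legal ← dec⇒maybe (legal? π (σ π))
  ¬end ← dec⇒maybe (¬? (ended? a 5 π′))
  outcome ← (inj₁ <$> boardInSHat? a π′) <∣> (inj₂ <$> ∀-legal? π′ reply?)
  just (legal , ¬end , outcome)
  where
  π′ = step π (σ π)
  reply? : ∀ m → Maybe (¬ Ended a 5 (step π′ m) × Reaches a σ t (step π′ m))
  reply? m = _,_ <$> dec⇒maybe (¬? (ended? a 5 (step π′ m))) <*> reaches? a σ t (step π′ m)

σ₅ : Strategy
σ₅ (2 ∷ 1 ∷ []) = 2
σ₅ (3 ∷ 1 ∷ 2 ∷ 4 ∷ []) = 1
σ₅ (4 ∷ 1 ∷ 2 ∷ 3 ∷ []) = 3
σ₅ (4 ∷ 1 ∷ 3 ∷ 2 ∷ []) = 1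
σ₅ (4 ∷ 2 ∷ 3 ∷ 1 ∷ []) = 5
σ₅ (5 ∷ 1 ∷ 2 ∷ 4 ∷ 3 ∷ 6 ∷ []) = 2
σ₅ (6 ∷ 1 ∷ 2 ∷ 4 ∷ 3 ∷ 5 ∷ []) = 1
σ₅ (6 ∷ 1 ∷ 2 ∷ 5 ∷ 3 ∷ 4 ∷ []) = 3
σ₅ (6 ∷ 1 ∷ 2 ∷ 5 ∷ 4 ∷ 3 ∷ []) = 5
σ₅ (6 ∷ 1 ∷ 3 ∷ 5 ∷ 4 ∷ 2 ∷ []) = 7
σ₅ (6 ∷ 2 ∷ 3 ∷ 5 ∷ 4 ∷ 1 ∷ []) = 6
σ₅ (1 ∷ 2 ∷ []) = 2
σ₅ (1 ∷ 3 ∷ 2 ∷ 4 ∷ []) = 1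
σ₅ (1 ∷ 4 ∷ 2 ∷ 3 ∷ []) = 3
σ₅ (1 ∷ 4 ∷ 3 ∷ 2 ∷ []) = 1
σ₅ (2 ∷ 4 ∷ 3 ∷ 1 ∷ []) = 5
σ₅ (1 ∷ 5 ∷ 2 ∷ 4 ∷ 3 ∷ 6 ∷ []) = 2
σ₅ (1 ∷ 6 ∷ 2 ∷ 4 ∷ 3 ∷ 5 ∷ []) = 1
σ₅ (1 ∷ 6 ∷ 2 ∷ 5 ∷ 3 ∷ 4 ∷ []) = 3
σ₅ (1 ∷ 6 ∷ 2 ∷ 5 ∷ 4 ∷ 3 ∷ []) = 5
σ₅ (1 ∷ 6 ∷ 3 ∷ 5 ∷ 4 ∷ 2 ∷ []) = 7
σ₅ (2 ∷ 6 ∷ 3 ∷ 5 ∷ 4 ∷ 1 ∷ []) = 6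
-- the remaining positions are never reached, except the opening, where 1 is the only move
σ₅ _ = 1

σ₆ : Strategy
σ₆ (2 ∷ 1 ∷ []) = 1
σ₆ (1 ∷ 2 ∷ []) = 2
σ₆ (1 ∷ 3 ∷ 2 ∷ 4 ∷ []) = 1
σ₆ (1 ∷ 4 ∷ 2 ∷ 3 ∷ []) = 2
σ₆ (1 ∷ 4 ∷ 3 ∷ 2 ∷ []) = 4
σ₆ (2 ∷ 4 ∷ 3 ∷ 1 ∷ []) = 5
σ₆ _ = 1

σ₅-wins : Reaches 5 σ₅ 4 []
σ₅-wins = from-just (reaches? 5 σ₅ 4 [])

σ₆-wins : Reaches 6 σ₆ 4 []
σ₆-wins = from-just (reaches? 6 σ₆ 4 [])

winning : ∀ n → ∃ λ σ → Reaches (5 + n) σ 4 []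
winning 0 = σ₅ , σ₅-wins
winning 1 = σ₆ , σ₆-wins
winning (suc (suc n)) = let σ , wins = winning n in σ , Reaches-+2 σ 4 [] wins

lemma1 : (a : ℕ) → 5 ≤ a → ∃ λ (σ : Strategy) → Reaches a σ 4 []
lemma1 _ (s≤s (s≤s (s≤s (s≤s (s≤s {n = n} z≤n))))) = winning n
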